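{- Let $\mathbb S$ be an outdegree sequence and let $\mathcal T_{\mathbb S}$ be the set of all rooted trees whose outdegree sequence is $\mathbb S$ (assumed nonempty). Then $\max_{T\in\mathcal T_{\mathbb S}}\max_{v\in V(T)}R_T(v)$ is attained as $R_T(r)$ for some $T\in\mathcal T_{\mathbb S}$ with root $r$.
   Context: The outdegree of a vertex in a rooted tree is its number of children; the outdegree sequence of a rooted tree is the multiset of outdegrees of its vertices. For a vertex $v$ of a rooted tree $T$, $T(v)$ is the subtree induced by $v$ and its descendants; a leaf is a vertex with no children. The rank $R_T(v)$ is the minimum distance from $v$ to a leaf of $T(v)$. -}

module Defs where

open import Data.Nat using (ℕ; zero; suc; _⊓_)
open import Data.List using (List; []; _∷_; _++_; length)

-- Finite rooted trees: a vertex together with the list of subtrees rooted at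
-- its children.  (Children are listed in some order; the order is irrelevant
-- for outdegrees and ranks.)
data Tree : Set where
  node : List Tree → Tree

outdeg : Tree → ℕ
outdeg (node ts) = length ts

mutual
  -- all vertices v of T, each represented by the subtree T(v)
  -- (root first, then recursively the children's subtrees)
  subtrees : Tree → List Tree
  subtrees (node ts) = node ts ∷ subtreesL ts

  subtreesL : List Tree → List Tree
  subtreesL [] = []
  subtreesL (t ∷ ts) = subtrees t ++ subtreesL ts

mutual
  -- outdegree sequence (as a list; compared up to permutation = multiset)
  outdegSeq : Tree → List ℕ
  outdegSeq (node ts) = length ts ∷ outdegSeqL ts

  outdegSeqL : List Tree → List ℕ
  outdegSeqL [] = []
  outdegSeqL (t ∷ ts) = outdegSeq t ++ outdegSeqL ts

mutual
  rank : Tree → ℕ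
  rank (node []) = zero
  rank (node (t ∷ ts)) = suc (minRank t ts)

  minRank : Tree → List Tree → ℕ
  minRank t [] = rank t
  minRank t (u ∷ us) = rank t ⊓ minRank u us

-- R_T(v) = rank of the subtree T(v); for v ∈ V(T) represented by T(v)
-- this is just `rank`.

-- Cut the subtree T(v) out of T, leaving a leaf in its place, and graft what
-- remains of T onto a leaf of T(v).  Every vertex keeps its outdegree, and the
-- new root has rank at least R_T(v), because rank is monotone in the subtree
-- plugged into a context and a leaf is the subtree of least rank.  Hence the
-- largest vertex rank over all trees with outdegree sequence S is bounded by
-- the largest root rank, which exists because such trees have |S| vertices and
-- so there are only finitely many of them.
module Submission where

open import Defs
open import Data.Nat using (ℕ; zero; suc; _≤_; z≤n; s≤s)
open import Data.Nat.Properties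
  using (_≟_; ≤-trans; ≤-reflexive; ≤-totalOrder; ≤-decTotalOrder; ⊓-monoˡ-≤; ⊓-monoʳ-≤)
open import Data.List using (List; []; _∷_; [_]; _++_; length; map; filter; cartesianProductWith)
open import Data.List.Properties using (≡-dec; ++-assoc; length-++-sucʳ; length-++-≤ˡ; length-++-≤ʳ)
open import Data.List.Sort ≤-decTotalOrder using (sort; sort-↭; sort-↗)
open import Data.List.Extrema.Nat using (argmax; argmax-all; f[xs]≤f[argmax])
open import Data.List.Membership.Propositional using (_∈_)
open import Data.List.Membership.Propositional.Properties
  using (∈-++⁻; ∈-map⁺; ∈-filter⁺; ∈-cartesianProductWith⁺)
open import Data.List.Relation.Unary.Any using (here; there)
open import Data.List.Relation.Unary.All using (All; []; _∷_; lookup)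
open import Data.List.Relation.Unary.All.Properties using (all-filter)
open import Data.List.Relation.Unary.Sorted.TotalOrder.Properties using (↗↭↗⇒≋)
open import Data.List.Relation.Binary.Equality.Propositional using (≋⇒≡)
open import Data.List.Relation.Binary.Permutation.Propositional
  using (_↭_; ↭-prep; ↭-sym; ↭-trans; ↭-reflexive; ↭⇒↭ₛ; module PermutationReasoning)
open import Data.List.Relation.Binary.Permutation.Propositional.Properties
  using (++⁺ˡ; ++-comm; shifts; ↭-length)
open import Data.Product using (Σ; _×_; _,_)
open import Data.Sum using (inj₁; inj₂)
open import Relation.Binary.PropositionalEquality using (_≡_; refl; sym; trans; cong; cong₂)
open import Relation.Nullary using (Dec)
open import Relation.Nullary.Decidable using (map′)

infix 4 _↭?_

_↭?_ : (xs ys : List ℕ) → Dec (xs ↭ ys)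
xs ↭? ys = map′ sort≡⇒↭ ↭⇒sort≡ (≡-dec _≟_ (sort xs) (sort ys))
  where
  sort≡⇒↭ : sort xs ≡ sort ys → xs ↭ ys
  sort≡⇒↭ eq = ↭-trans (↭-sym (sort-↭ xs)) (↭-trans (↭-reflexive eq) (sort-↭ ys))

  ↭⇒sort≡ : xs ↭ ys → sort xs ≡ sort ys
  ↭⇒sort≡ p = ≋⇒≡ (↗↭↗⇒≋ ≤-totalOrder (sort-↗ xs) (sort-↗ ys)
    (↭⇒↭ₛ (↭-trans (sort-↭ xs) (↭-trans p (↭-sym (sort-↭ ys))))))

leaf : Tree
leaf = node []

data Context : Set where
  hole : Context
  step : List Tree → Context → List Tree → Context

plug : Context → Tree → Tree
plug hole X = X
plug (step ls C rs) X = node (ls ++ plug C X ∷ rs)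

mutual
  ∈-subtrees⇒plug : ∀ {v} T → v ∈ subtrees T → Σ Context λ C → T ≡ plug C v
  ∈-subtrees⇒plug (node ts) (here eq) = hole , sym eq
  ∈-subtrees⇒plug (node ts) (there v∈) with ∈-subtreesL⇒plug ts v∈
  ... | ls , C , rs , eq = step ls C rs , cong node eq

  ∈-subtreesL⇒plug : ∀ {v} ts → v ∈ subtreesL ts →
    Σ (List Tree) λ ls → Σ Context λ C → Σ (List Tree) λ rs → ts ≡ ls ++ plug C v ∷ rs
  ∈-subtreesL⇒plug (t ∷ ts) v∈ with ∈-++⁻ (subtrees t) v∈
  ... | inj₁ v∈t with ∈-subtrees⇒plug t v∈t
  ...   | C , eq = [] , C , ts , cong (_∷ ts) eq
  ∈-subtreesL⇒plug (t ∷ ts) v∈ | inj₂ v∈ts with ∈-subtreesL⇒plug ts v∈ts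
  ... | ls , C , rs , eq = t ∷ ls , C , rs , cong (t ∷_) eq

plug-leaf : ∀ X → Σ Context λ D → X ≡ plug D leaf
plug-leaf (node []) = hole , refl
plug-leaf (node (t ∷ ts)) with plug-leaf t
... | D , eq = step [] D ts , cong (λ u → node (u ∷ ts)) eq

outdegSeqᶜ : Context → List ℕ
outdegSeqᶜ hole = []
outdegSeqᶜ (step ls C rs) = suc (length (ls ++ rs)) ∷ outdegSeqL ls ++ outdegSeqL rs ++ outdegSeqᶜ C

outdegSeqL-++ : ∀ ts us → outdegSeqL (ts ++ us) ≡ outdegSeqL ts ++ outdegSeqL us
outdegSeqL-++ [] us = refl
outdegSeqL-++ (t ∷ ts) us =
  trans (cong (outdegSeq t ++_) (outdegSeqL-++ ts us)) (sym (++-assoc (outdegSeq t) _ _))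

outdegSeq-plug : ∀ C X → outdegSeq (plug C X) ↭ outdegSeqᶜ C ++ outdegSeq X
outdegSeq-plug hole X = ↭-reflexive refl
outdegSeq-plug (step ls C rs) X = begin
  length (ls ++ plug C X ∷ rs) ∷ outdegSeqL (ls ++ plug C X ∷ rs)
    ≡⟨ cong₂ _∷_ (length-++-sucʳ ls (plug C X) rs) (outdegSeqL-++ ls (plug C X ∷ rs)) ⟩
  d ∷ (A ++ outdegSeq (plug C X) ++ R)
    ↭⟨ ↭-prep d (++⁺ˡ A (++-comm (outdegSeq (plug C X)) R)) ⟩
  d ∷ (A ++ R ++ outdegSeq (plug C X))
    ↭⟨ ↭-prep d (++⁺ˡ A (++⁺ˡ R (outdegSeq-plug C X))) ⟩
  d ∷ (A ++ R ++ outdegSeqᶜ C ++ outdegSeq X)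
    ≡⟨ cong (d ∷_) (trans (cong (A ++_) (sym (++-assoc R _ _))) (sym (++-assoc A _ _))) ⟩
  outdegSeqᶜ (step ls C rs) ++ outdegSeq X ∎
  where
  open PermutationReasoning
  d = suc (length (ls ++ rs))
  A = outdegSeqL ls
  R = outdegSeqL rs

outdegSeq-plug-comm : ∀ C D → outdegSeq (plug D (plug C leaf)) ↭ outdegSeq (plug C (plug D leaf))
outdegSeq-plug-comm C D = begin
  outdegSeq (plug D (plug C leaf))    ↭⟨ outdegSeq-plug D (plug C leaf) ⟩
  outdegSeqᶜ D ++ outdegSeq (plug C leaf) ↭⟨ ++⁺ˡ (outdegSeqᶜ D) (outdegSeq-plug C leaf) ⟩
  outdegSeqᶜ D ++ outdegSeqᶜ C ++ [ 0 ] ↭⟨ shifts (outdegSeqᶜ D) (outdegSeqᶜ C) ⟩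
  outdegSeqᶜ C ++ outdegSeqᶜ D ++ [ 0 ] ↭⟨ ++⁺ˡ (outdegSeqᶜ C) (outdegSeq-plug D leaf) ⟨
  outdegSeqᶜ C ++ outdegSeq (plug D leaf) ↭⟨ outdegSeq-plug C (plug D leaf) ⟨
  outdegSeq (plug C (plug D leaf))    ∎
  where open PermutationReasoning

minRank-monoˡ : ∀ {a b} ts → rank a ≤ rank b → minRank a ts ≤ minRank b ts
minRank-monoˡ [] a≤b = a≤b
minRank-monoˡ (u ∷ us) a≤b = ⊓-monoˡ-≤ (minRank u us) a≤b

minRank-monoʳ : ∀ {a b} t ls rs → rank a ≤ rank b →
  minRank t (ls ++ a ∷ rs) ≤ minRank t (ls ++ b ∷ rs)
minRank-monoʳ t [] rs a≤b = ⊓-monoʳ-≤ (rank t) (minRank-monoˡ rs a≤b)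
minRank-monoʳ t (l ∷ ls) rs a≤b = ⊓-monoʳ-≤ (rank t) (minRank-monoʳ l ls rs a≤b)

rank-node-mono : ∀ {a b} ls rs → rank a ≤ rank b →
  rank (node (ls ++ a ∷ rs)) ≤ rank (node (ls ++ b ∷ rs))
rank-node-mono [] rs a≤b = s≤s (minRank-monoˡ rs a≤b)
rank-node-mono (l ∷ ls) rs a≤b = s≤s (minRank-monoʳ l ls rs a≤b)

rank-plug-mono : ∀ {a b} C → rank a ≤ rank b → rank (plug C a) ≤ rank (plug C b)
rank-plug-mono hole a≤b = a≤b
rank-plug-mono (step ls C rs) a≤b = rank-node-mono ls rs (rank-plug-mono C a≤b)

subtree-rank≤regrafted-root-rank : ∀ T v → v ∈ subtrees T →
  Σ Tree λ T″ → outdegSeq T″ ↭ outdegSeq T × rank v ≤ rank T″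
subtree-rank≤regrafted-root-rank T v v∈T with ∈-subtrees⇒plug T v∈T | plug-leaf v
... | C , refl | D , refl =
  plug D (plug C leaf) , outdegSeq-plug-comm C D , rank-plug-mono D z≤n

module _ {a} {A : Set a} where

  listsOfLength≤ : ℕ → List A → List (List A)
  listsOfLength≤ zero xs = [ [] ]
  listsOfLength≤ (suc n) xs = [] ∷ cartesianProductWith _∷_ xs (listsOfLength≤ n xs)

  ∈-listsOfLength≤ : ∀ n xs {ys} → length ys ≤ n → All (_∈ xs) ys → ys ∈ listsOfLength≤ n xs
  ∈-listsOfLength≤ zero xs z≤n [] = here refl
  ∈-listsOfLength≤ (suc n) xs z≤n [] = here refl
  ∈-listsOfLength≤ (suc n) xs (s≤s |ys|≤n) (y∈xs ∷ ys⊆xs) =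
    there (∈-cartesianProductWith⁺ _∷_ y∈xs (∈-listsOfLength≤ n xs |ys|≤n ys⊆xs))

-- Contains every tree with at most n vertices, and some larger ones as well.
treesOfSize≤ : ℕ → List Tree
treesOfSize≤ zero = []
treesOfSize≤ (suc n) = map node (listsOfLength≤ n (treesOfSize≤ n))

length≤length-outdegSeqL : ∀ ts → length ts ≤ length (outdegSeqL ts)
length≤length-outdegSeqL [] = z≤n
length≤length-outdegSeqL (node us ∷ ts) =
  s≤s (≤-trans (length≤length-outdegSeqL ts) (length-++-≤ʳ (outdegSeqL ts) {outdegSeqL us}))

mutual
  ∈-treesOfSize≤ : ∀ n T → length (outdegSeq T) ≤ n → T ∈ treesOfSize≤ n
  ∈-treesOfSize≤ (suc n) (node ts) (s≤s |T|≤n) = ∈-map⁺ node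
    (∈-listsOfLength≤ n (treesOfSize≤ n) (≤-trans (length≤length-outdegSeqL ts) |T|≤n)
      (All-∈-treesOfSize≤ n ts |T|≤n))

  All-∈-treesOfSize≤ : ∀ n ts → length (outdegSeqL ts) ≤ n → All (_∈ treesOfSize≤ n) ts
  All-∈-treesOfSize≤ n [] _ = []
  All-∈-treesOfSize≤ n (t ∷ ts) |ts|≤n =
    ∈-treesOfSize≤ n t (≤-trans (length-++-≤ˡ (outdegSeq t)) |ts|≤n)
    ∷ All-∈-treesOfSize≤ n ts (≤-trans (length-++-≤ʳ (outdegSeqL ts) {outdegSeq t}) |ts|≤n)

treesWithOutdegSeq : List ℕ → List Tree
treesWithOutdegSeq S = filter (λ T → outdegSeq T ↭? S) (treesOfSize≤ (length S))

∈-treesWithOutdegSeq : ∀ {S} T → outdegSeq T ↭ S → T ∈ treesWithOutdegSeq S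
∈-treesWithOutdegSeq T T↭S =
  ∈-filter⁺ (λ T → outdegSeq T ↭? _) (∈-treesOfSize≤ _ T (≤-reflexive (↭-length T↭S))) T↭S

treesWithOutdegSeq-↭ : ∀ S → All (λ T → outdegSeq T ↭ S) (treesWithOutdegSeq S)
treesWithOutdegSeq-↭ S = all-filter (λ T → outdegSeq T ↭? S) (treesOfSize≤ (length S))

proposition4p7 : (S : List ℕ) → Σ Tree (λ T₀ → outdegSeq T₀ ↭ S) →
    Σ Tree (λ T → outdegSeq T ↭ S ×
      ((T′ : Tree) → outdegSeq T′ ↭ S → (v : Tree) → v ∈ subtrees T′ →
        rank v ≤ rank T))
proposition4p7 S (T₀ , T₀↭S) =
  T , argmax-all rank T₀↭S (treesWithOutdegSeq-↭ S) , maximal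
  where
  T : Tree
  T = argmax rank T₀ (treesWithOutdegSeq S)

  maximal : (T′ : Tree) → outdegSeq T′ ↭ S → (v : Tree) → v ∈ subtrees T′ → rank v ≤ rank T
  maximal T′ T′↭S v v∈T′ with subtree-rank≤regrafted-root-rank T′ v v∈T′
  ... | T″ , T″↭T′ , v≤T″ = ≤-trans v≤T″
    (lookup (f[xs]≤f[argmax] T₀ (treesWithOutdegSeq S)) (∈-treesWithOutdegSeq T″ (↭-trans T″↭T′ T′↭S)))
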